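{- Each of the following intervals $[\mathcal{D}_1,\mathcal{D}_2]=\{\mathcal{K}\in{\bf E}_{\mathbb{B}}:\mathcal{D}_1\subseteq\mathcal{K}\subseteq\mathcal{D}_2\}$ contains uncountably many equational classes: (i) $[I_c,SM]$; (ii) $[\mathcal{C}\cap S_c,S_c]$ for $\mathcal{C}\in\{M,L\}$; (iii) $[\mathcal{C}\cap S,S]$ for $\mathcal{C}\in\{T_c,L\}$.
   Context: Boolean functions are maps $\{0,1\}^n\to\{0,1\}$, $n\ge1$. An equational class is a set of Boolean functions closed under $f\mapsto f(p_1,\dots,p_n)$ for projections $p_i$; ${\bf E}_{\mathbb{B}}$ is the set of them. $I_c$ is the class of all projections. The dual of $n$-ary $f$ is $f^d({\bf a})=1-f(\bar{\bf a})$ ($\bar{\bf a}$ the componentwise complement); $S=\{f:f^d=f\}$. $T_c=\{f:f(0,\dots,0)=0,\ f(1,\dots,1)=1\}$; $S_c=S\cap T_c$; $M$ = monotone functions; $SM=S\cap M$; $L$ = functions $c_0\oplus c_1x_1\oplus\cdots\oplus c_nx_n$ with $c_i\in\{0,1\}$ ($\oplus$ addition mod 2). -}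

module Defs where

open import Data.Nat using (ℕ; suc)
open import Data.Fin using (Fin; zero; suc)
open import Data.Bool using (Bool; true; false; not; _∧_; _xor_; _≤_)
open import Data.Product using (Σ; Σ-syntax; ∃; ∃-syntax; _×_; _,_)
open import Relation.Binary.PropositionalEquality using (_≡_)
open import Relation.Nullary using (¬_)

-- A Boolean function of arity suc n ≥ 1: {0,1}^(suc n) → {0,1}.
BF : Set
BF = Σ[ n ∈ ℕ ] ((Fin (suc n) → Bool) → Bool)

Class : Set₁
Class = BF → Set

_⊆_ : Class → Class → Set
A ⊆ B = ∀ f → A f → B f

_∩_ : Class → Class → Class
(A ∩ B) f = A f × B f

_≈_ : Class → Class → Set
A ≈ B = (A ⊆ B) × (B ⊆ A)

IsMinorOf : BF → BF → Set
IsMinorOf (m , g) (n , f) =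
  Σ[ σ ∈ (Fin (suc n) → Fin (suc m)) ] (∀ x → g x ≡ f (λ i → x (σ i)))

IsEquational : Class → Set
IsEquational K = ∀ f g → K f → IsMinorOf g f → K g

InInterval : Class → Class → Class → Set
InInterval D₁ D₂ K = IsEquational K × (D₁ ⊆ K) × (K ⊆ D₂)

-- The interval contains uncountably many equational classes: no sequence of
-- classes exhausts it (up to extensional equality).
UncountableInterval : Class → Class → Set₁
UncountableInterval D₁ D₂ =
  ¬ (Σ[ e ∈ (ℕ → Class) ] (∀ K → InInterval D₁ D₂ K → ∃[ k ] (e k ≈ K)))

Ic : Class
Ic (n , f) = ∃[ i ] (∀ x → f x ≡ x i)

dual : BF → BF
dual (n , f) = n , (λ a → not (f (λ i → not (a i))))

S : Class
S (n , f) = ∀ x → f x ≡ not (f (λ i → not (x i)))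

Tc : Class
Tc (n , f) = (f (λ _ → false) ≡ false) × (f (λ _ → true) ≡ true)

Sc : Class
Sc = S ∩ Tc

M : Class
M (n , f) = ∀ x y → (∀ i → x i ≤ y i) → f x ≤ f y

SM : Class
SM = S ∩ M

xorSum : ∀ {k} → (Fin k → Bool) → (Fin k → Bool) → Bool
xorSum {ℕ.zero} c x = false
xorSum {suc k} c x = (c zero ∧ x zero) xor xorSum (λ i → c (suc i)) (λ i → x (suc i))

L : Class
L (n , f) = Σ[ c₀ ∈ Bool ] Σ[ c ∈ (Fin (suc n) → Bool) ] (∀ x → f x ≡ c₀ xor xorSum c x)

-- If D₁ ⊆ D₂ are equational and there is a
-- sequence φ₀, φ₁, … in D₂, pairwise incomparable in the minor order, none of which is a
-- minor of a member of D₁, then any enumeration K₀, K₁, … of the interval misses the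
-- class of minors of D₁ ∪ {φⱼ : φⱼ ∉ Kⱼ}, which differs from Kₖ at φₖ.
--
-- For [I_c, SM] the antichain is ψₖ(x₀, x) = (x₀ ∧ |x| ≥ 2) ∨ (¬x₀ ∧ |x| ≥ n − 1) on
-- n = k + 5 further variables; for the other intervals it is the self-dual symmetric
-- function on 2m + 1 variables (m = k + 3) which, on tuples of weight at most m, is true
-- exactly at weight one (negated for [T_c ∩ S, S]). If φₖ is a minor of φⱼ via an
-- identification map σ, evaluating φₖ on tuples of weight one, two and three bounds the
-- sizes of the fibres of σ so tightly that every fibre is a singleton, so both functions
-- have the same arity and j = k.

module Submission where

open import Defs
open import Algebra.Bundles using (CommutativeRing)
open import Data.Bool using (Bool; true; false; not; _∧_; _∨_; _xor_; if_then_else_; f≤t; b≤b)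
  renaming (_≤_ to _≤ᴮ_)
open import Data.Bool.Properties
  using (not-involutive; not-injective; ∧-distribˡ-xor; ∧-distribˡ-∨; xor-∧-commutativeRing;
         ≤-minimum; ≤-maximum)
  renaming (≤-trans to ≤ᴮ-trans)
open import Data.Empty using (⊥; ⊥-elim)
open import Data.Fin using (Fin; zero; suc; _≟_)
open import Data.Fin.Properties using (cantor-schröder-bernstein)
import Data.Fin.Properties as Fin
import Data.Nat as ℕ
open import Data.Nat using (ℕ; zero; suc; _+_; _≤_; _≤?_; z≤n; s≤s)
open import Data.Nat.Properties
  using (+-suc; +-comm; +-mono-≤; +-monoʳ-≤; m≤n⇒m≤1+n; m≤m+n; m≤n+m; ≤-trans; ≤-pred; ≰⇒>;
         1+n≰n; suc-injective; 0≢1+n; +-cancelˡ-≡; +-cancelʳ-≡)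
open import Data.Product using (∃-syntax; _×_; _,_; proj₁; proj₂)
open import Data.Sum using (_⊎_; inj₁; inj₂)
open import Data.Vec.Functional using (tail)
open import Function using (_∘_; id)
open import Relation.Binary.PropositionalEquality
  using (_≡_; _≢_; refl; sym; trans; cong; cong₂; subst; subst₂; module ≡-Reasoning)
open import Relation.Nullary using (¬_; Dec; yes; no; does)
open import Relation.Nullary.Decidable using (dec-true; dec-false)
open import Algebra.Properties.CommutativeSemigroup
  (CommutativeRing.+-commutativeSemigroup xor-∧-commutativeRing) using (interchange)

private variable
  m n : ℕ

true≢false : true ≢ false
true≢false ()

does≡true⇒ : ∀ {A : Set} (a? : Dec A) → does a? ≡ true → A
does≡true⇒ (yes a) _ = a

does≡false⇒¬ : ∀ {A : Set} (a? : Dec A) → does a? ≡ false → ¬ A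
does≡false⇒¬ (no ¬a) _ = ¬a

does-mono : ∀ {A B : Set} → (A → B) → (a? : Dec A) (b? : Dec B) → does a? ≤ᴮ does b?
does-mono A→B (yes a) (yes _) = b≤b
does-mono A→B (yes a) (no ¬b) = ⊥-elim (¬b (A→B a))
does-mono A→B (no _)  b?      = ≤-minimum (does b?)

does-¬⇒ : ∀ {A B : Set} → (¬ A → B) → (a? : Dec A) (b? : Dec B) → not (does a?) ≤ᴮ does b?
does-¬⇒ ¬A→B (yes _)  b?      = ≤-minimum (does b?)
does-¬⇒ ¬A→B (no _)   (yes _) = b≤b
does-¬⇒ ¬A→B (no ¬a)  (no ¬b) = ⊥-elim (¬b (¬A→B ¬a))

not-antitone : ∀ {a b} → a ≤ᴮ b → not b ≤ᴮ not a
not-antitone f≤t = f≤t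
not-antitone b≤b = b≤b

≤∨ : ∀ a b → a ≤ᴮ a ∨ b
≤∨ true  b = b≤b
≤∨ false b = ≤-minimum b

xor-affine : ∀ c a b → c xor (a xor b) ≡ ((c xor a) xor (c xor b)) xor (c xor false)
xor-affine false false false = refl
xor-affine false false true  = refl
xor-affine false true  false = refl
xor-affine false true  true  = refl
xor-affine true  false false = refl
xor-affine true  false true  = refl
xor-affine true  true  false = refl
xor-affine true  true  true  = refl

Tuple : ℕ → Set
Tuple n = Fin n → Bool

∁ : Tuple n → Tuple n
∁ x i = not (x i)

infixr 6 _∪_
_∪_ : Tuple n → Tuple n → Tuple n
(x ∪ y) i = x i ∨ y i

_⊕_ : Tuple n → Tuple n → Tuple n
(x ⊕ y) i = x i xor y i

⁅_⁆ : Fin n → Tuple n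
⁅ r ⁆ i = does (i ≟ r)

Disjoint : Tuple n → Tuple n → Set
Disjoint x y = ∀ i → x i ∧ y i ≡ false

⁅⁆-self : (r : Fin n) → ⁅ r ⁆ r ≡ true
⁅⁆-self r = dec-true (r ≟ r) refl

⁅⁆-true⇒≡ : {i r : Fin n} → ⁅ r ⁆ i ≡ true → i ≡ r
⁅⁆-true⇒≡ {i = i} {r} = does≡true⇒ (i ≟ r)

⁅⁆-disjoint : {r s : Fin n} → r ≢ s → Disjoint ⁅ r ⁆ ⁅ s ⁆
⁅⁆-disjoint {r = r} {s} r≢s i with i ≟ r | i ≟ s
... | yes refl | yes refl = ⊥-elim (r≢s refl)
... | yes _    | no _     = refl
... | no _     | _        = refl

disjoint-∪ : {x y z : Tuple n} → Disjoint x y → Disjoint x z → Disjoint x (y ∪ z)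
disjoint-∪ {x = x} {y} {z} x#y x#z i =
  trans (∧-distribˡ-∨ (x i) (y i) (z i)) (cong₂ _∨_ (x#y i) (x#z i))

⊕≗∪ : {x y : Tuple n} → Disjoint x y → ∀ i → (x ⊕ y) i ≡ (x ∪ y) i
⊕≗∪ {x = x} {y} x#y i with x i | y i | x#y i
... | false | _     | _ = refl
... | true  | false | _ = refl

weight : Tuple n → ℕ
weight {zero}  x = 0
weight {suc n} x = if x zero then suc (weight (tail x)) else weight (tail x)

weight-cong : {x y : Tuple n} → (∀ i → x i ≡ y i) → weight x ≡ weight y
weight-cong {zero}  x≗y = refl
weight-cong {suc n} {x} {y} x≗y
  rewrite x≗y zero | weight-cong {x = tail x} {tail y} (x≗y ∘ suc) = refl

weight-head-true : (x : Tuple (suc n)) → x zero ≡ true → weight x ≡ suc (weight (tail x))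
weight-head-true x x₀ rewrite x₀ = refl

weight-head-false : (x : Tuple (suc n)) → x zero ≡ false → weight x ≡ weight (tail x)
weight-head-false x x₀ rewrite x₀ = refl

weight-∪ : {x y : Tuple n} → Disjoint x y → weight (x ∪ y) ≡ weight x + weight y
weight-∪ {zero} _ = refl
weight-∪ {suc n} {x} {y} x#y
  with x zero | y zero | x#y zero | weight-∪ {x = tail x} {tail y} (x#y ∘ suc)
... | false | false | _ | ih = ih
... | false | true  | _ | ih = trans (cong suc ih) (sym (+-suc _ _))
... | true  | false | _ | ih = cong suc ih

weight+weight∁≡n : (x : Tuple n) → weight x + weight (∁ x) ≡ n
weight+weight∁≡n {zero}  x = refl
weight+weight∁≡n {suc n} x with x zero | weight+weight∁≡n (tail x)
... | false | ih = trans (+-suc _ _) (cong suc ih)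
... | true  | ih = cong suc ih

weight-mono : {x y : Tuple n} → (∀ i → x i ≤ᴮ y i) → weight x ≤ weight y
weight-mono {zero} _ = z≤n
weight-mono {suc n} {x} {y} x≤y
  with x zero | y zero | x≤y zero | weight-mono {x = tail x} {tail y} (x≤y ∘ suc)
... | false | false | _ | ih = ih
... | false | true  | _ | ih = m≤n⇒m≤1+n ih
... | true  | true  | _ | ih = s≤s ih

weight-⊥ : ∀ n → weight {n} (λ _ → false) ≡ 0
weight-⊥ zero    = refl
weight-⊥ (suc n) = weight-⊥ n

weight-⁅⁆ : (r : Fin n) → weight ⁅ r ⁆ ≡ 1
weight-⁅⁆ {suc n} zero    = cong suc (weight-⊥ n)
weight-⁅⁆         (suc r) = weight-⁅⁆ r

weight≡0⇒⊥ : (x : Tuple n) → weight x ≡ 0 → ∀ i → x i ≡ false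
weight≡0⇒⊥ {suc n} x w≡0 i with x zero in x₀
weight≡0⇒⊥ {suc n} x w≡0 zero    | false = x₀
weight≡0⇒⊥ {suc n} x w≡0 (suc i) | false = weight≡0⇒⊥ (tail x) w≡0 i

weight≡1⇒⁅⁆ : (x : Tuple n) → weight x ≡ 1 → ∃[ i ] (∀ j → x j ≡ ⁅ i ⁆ j)
weight≡1⇒⁅⁆ {suc n} x w≡1 with x zero in x₀
... | true  = zero , λ { zero → x₀ ; (suc j) → weight≡0⇒⊥ (tail x) (suc-injective w≡1) j }
... | false with weight≡1⇒⁅⁆ (tail x) w≡1
...   | i , x≗⁅i⁆ = suc i , λ { zero → x₀ ; (suc j) → x≗⁅i⁆ j }

weight∁≡ : ∀ w {x : Tuple (w + n)} → weight x ≡ w → weight (∁ x) ≡ n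
weight∁≡ w {x} wx≡w =
  +-cancelˡ-≡ w _ _ (trans (cong (_+ weight (∁ x)) (sym wx≡w)) (weight+weight∁≡n x))

Distinct : Fin n → Fin n → Fin n → Set
Distinct r s u = r ≢ s × r ≢ u × s ≢ u

two-others : (r : Fin (3 + n)) → ∃[ s ] ∃[ u ] Distinct r s u
two-others zero             = suc zero , suc (suc zero) , (λ ()) , (λ ()) , (λ ())
two-others (suc zero)       = zero , suc (suc zero) , (λ ()) , (λ ()) , (λ ())
two-others (suc (suc r))    = zero , suc zero , (λ ()) , (λ ()) , (λ ())

module _ (σ : Fin m → Fin n) where

  weight-pair∘ : {r s : Fin n} → r ≢ s →
                 weight ((⁅ r ⁆ ∪ ⁅ s ⁆) ∘ σ) ≡ weight (⁅ r ⁆ ∘ σ) + weight (⁅ s ⁆ ∘ σ)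
  weight-pair∘ r≢s = weight-∪ (⁅⁆-disjoint r≢s ∘ σ)

  weight-triple∘ : {r s u : Fin n} → Distinct r s u →
                   weight ((⁅ r ⁆ ∪ ⁅ s ⁆ ∪ ⁅ u ⁆) ∘ σ)
                     ≡ weight (⁅ r ⁆ ∘ σ) + (weight (⁅ s ⁆ ∘ σ) + weight (⁅ u ⁆ ∘ σ))
  weight-triple∘ {r} {s} {u} (r≢s , r≢u , s≢u) =
    trans (weight-∪ (r#s∪u ∘ σ)) (cong (weight (⁅ r ⁆ ∘ σ) +_) (weight-pair∘ s≢u))
    where
    r#s∪u : Disjoint ⁅ r ⁆ (⁅ s ⁆ ∪ ⁅ u ⁆)
    r#s∪u = disjoint-∪ {x = ⁅ r ⁆} {⁅ s ⁆} {⁅ u ⁆} (⁅⁆-disjoint r≢s) (⁅⁆-disjoint r≢u)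

  singleton-fibres⇒≡ : (∀ r → weight (⁅ r ⁆ ∘ σ) ≡ 1) → m ≡ n
  singleton-fibres⇒≡ fibre≡1 = cantor-schröder-bernstein σ-injective ι-injective
    where
    ι : Fin n → Fin m
    ι r = proj₁ (weight≡1⇒⁅⁆ (⁅ r ⁆ ∘ σ) (fibre≡1 r))

    fibre : ∀ r i → ⁅ r ⁆ (σ i) ≡ ⁅ ι r ⁆ i
    fibre r = proj₂ (weight≡1⇒⁅⁆ (⁅ r ⁆ ∘ σ) (fibre≡1 r))

    in-fibre : ∀ {r i} → σ i ≡ r → i ≡ ι r
    in-fibre {r} {i} refl = ⁅⁆-true⇒≡ (trans (sym (fibre r i)) (⁅⁆-self r))

    σ-injective : ∀ {i j} → σ i ≡ σ j → i ≡ j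
    σ-injective σi≡σj = trans (in-fibre refl) (sym (in-fibre (sym σi≡σj)))

    σ∘ι : ∀ r → σ (ι r) ≡ r
    σ∘ι r = ⁅⁆-true⇒≡ (trans (fibre r (ι r)) (⁅⁆-self (ι r)))

    ι-injective : ∀ {r s} → ι r ≡ ι s → r ≡ s
    ι-injective {r} {s} ιr≡ιs = trans (sym (σ∘ι r)) (trans (cong σ ιr≡ιs) (σ∘ι s))

weight-pair : {r s : Fin n} → r ≢ s → weight (⁅ r ⁆ ∪ ⁅ s ⁆) ≡ 2
weight-pair {r = r} {s} r≢s =
  trans (weight-pair∘ id r≢s) (cong₂ _+_ (weight-⁅⁆ r) (weight-⁅⁆ s))

weight-triple : {r s u : Fin n} → Distinct r s u → weight (⁅ r ⁆ ∪ ⁅ s ⁆ ∪ ⁅ u ⁆) ≡ 3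
weight-triple {r = r} {s} {u} d =
  trans (weight-triple∘ id d) (cong₂ _+_ (weight-⁅⁆ r) (cong₂ _+_ (weight-⁅⁆ s) (weight-⁅⁆ u)))

-- Minors and the diagonal argument

minor-refl : (f : BF) → IsMinorOf f f
minor-refl _ = id , λ _ → refl

minor-trans : (f g h : BF) → IsMinorOf f g → IsMinorOf g h → IsMinorOf f h
minor-trans _ _ _ (σ , f≡g∘σ) (τ , g≡h∘τ) =
  σ ∘ τ , λ x → trans (f≡g∘σ x) (g≡h∘τ (x ∘ σ))

↓ : Class → Class
↓ A f = ∃[ g ] (A g × IsMinorOf f g)

↓-equational : (A : Class) → IsEquational (↓ A)
↓-equational A f g (h , h∈A , f≤h) g≤f = h , h∈A , minor-trans g f h g≤f f≤h

⊆↓ : (A : Class) → A ⊆ ↓ A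
⊆↓ A f f∈A = f , f∈A , minor-refl f

↓-least : {A B : Class} → IsEquational B → A ⊆ B → ↓ A ⊆ B
↓-least B-equational A⊆B f (g , g∈A , f≤g) = B-equational g f (A⊆B g g∈A) f≤g

record SeparatingAntichain (D₁ D₂ : Class) : Set₁ where
  field
    D₂-equational : IsEquational D₂
    D₁⊆D₂         : D₁ ⊆ D₂
    C             : Class
    C-equational  : IsEquational C
    D₁⊆C          : D₁ ⊆ C
    φ             : ℕ → BF
    φ∈D₂          : ∀ k → D₂ (φ k)
    φ∉C           : ∀ k → ¬ C (φ k)
    antichain     : ∀ j k → IsMinorOf (φ k) (φ j) → j ≡ k

uncountable : {D₁ D₂ : Class} → SeparatingAntichain D₁ D₂ → UncountableInterval D₁ D₂
uncountable {D₁} {D₂} A (e , enumerates) =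
  φk∉ek (ek≈K₂ (φ k) (⊆↓ Seed (φ k) (inj₂ (k , φk∉ek , refl))))
  where
  open SeparatingAntichain A

  Seed : Class
  Seed f = D₁ f ⊎ ∃[ j ] (¬ e j (φ j) × f ≡ φ j)

  Seed⊆D₂ : Seed ⊆ D₂
  Seed⊆D₂ f (inj₁ f∈D₁)          = D₁⊆D₂ f f∈D₁
  Seed⊆D₂ f (inj₂ (j , _ , refl)) = φ∈D₂ j

  K-in-interval : InInterval D₁ D₂ (↓ Seed)
  K-in-interval =
    ↓-equational Seed , (λ f → ⊆↓ Seed f ∘ inj₁) , ↓-least D₂-equational Seed⊆D₂

  k = proj₁ (enumerates (↓ Seed) K-in-interval)
  ek≈K₁ = proj₁ (proj₂ (enumerates (↓ Seed) K-in-interval))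
  ek≈K₂ = proj₂ (proj₂ (enumerates (↓ Seed) K-in-interval))

  φk∉ek : ¬ e k (φ k)
  φk∉ek φk∈ek with ek≈K₁ (φ k) φk∈ek
  ... | g , inj₁ g∈D₁ , φk≤g = φ∉C k (C-equational g (φ k) (D₁⊆C g g∈D₁) φk≤g)
  ... | _ , inj₂ (j , φj∉ej , refl) , φk≤φj with antichain j k φk≤φj
  ...   | refl = φj∉ej φk∈ek

S-equational : IsEquational S
S-equational (_ , F) (_ , G) F-selfDual (σ , G≡F∘σ) x = begin
  G x                 ≡⟨ G≡F∘σ x ⟩
  F (x ∘ σ)           ≡⟨ F-selfDual (x ∘ σ) ⟩
  not (F (∁ x ∘ σ))   ≡⟨ cong not (G≡F∘σ (∁ x)) ⟨
  not (G (∁ x))       ∎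
  where open ≡-Reasoning

Tc-equational : IsEquational Tc
Tc-equational _ _ (F₀ , F₁) (σ , G≡F∘σ) = trans (G≡F∘σ _) F₀ , trans (G≡F∘σ _) F₁

M-equational : IsEquational M
M-equational (_ , F) (_ , G) F-mono (σ , G≡F∘σ) x y x≤y
  rewrite G≡F∘σ x | G≡F∘σ y = F-mono (x ∘ σ) (y ∘ σ) (x≤y ∘ σ)

Ic-equational : IsEquational Ic
Ic-equational _ _ (i , F≡xᵢ) (σ , G≡F∘σ) =
  σ i , λ x → trans (G≡F∘σ x) (F≡xᵢ (x ∘ σ))

∩-equational : {A B : Class} → IsEquational A → IsEquational B → IsEquational (A ∩ B)
∩-equational A-eq B-eq f g (f∈A , f∈B) g≤f = A-eq f g f∈A g≤f , B-eq f g f∈B g≤f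

Ic⊆SM : Ic ⊆ SM
Ic⊆SM (_ , F) (i , F≡xᵢ) =
  (λ x → trans (F≡xᵢ x) (trans (sym (not-involutive (x i))) (cong not (sym (F≡xᵢ (∁ x)))))) ,
  (λ x y x≤y → subst₂ _≤ᴮ_ (sym (F≡xᵢ x)) (sym (F≡xᵢ y)) (x≤y i))

selfDual⇒Tc : (f : BF) → S f → proj₂ f (λ _ → false) ≡ false → Tc f
selfDual⇒Tc (_ , F) F-selfDual F₀ = F₀ , trans (F-selfDual (λ _ → true)) (cong not F₀)

-- Every member of L satisfies this identity, and unlike the coefficient description of L
-- it is plainly inherited by minors.
Affine : Class
Affine (_ , F) = ∀ x y → F (x ⊕ y) ≡ (F x xor F y) xor F (λ _ → false)

Affine-equational : IsEquational Affine
Affine-equational (_ , F) (_ , G) F-affine (σ , G≡F∘σ) x y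
  rewrite G≡F∘σ (x ⊕ y) | G≡F∘σ x | G≡F∘σ y | G≡F∘σ (λ _ → false) =
    F-affine (x ∘ σ) (y ∘ σ)

xorSum-⊕ : ∀ {n} (c x y : Tuple n) → xorSum c (x ⊕ y) ≡ xorSum c x xor xorSum c y
xorSum-⊕ {zero}  c x y = refl
xorSum-⊕ {suc n} c x y = begin
  (c zero ∧ (x zero xor y zero)) xor xorSum (tail c) (tail x ⊕ tail y)
    ≡⟨ cong₂ _xor_ (∧-distribˡ-xor (c zero) (x zero) (y zero)) (xorSum-⊕ (tail c) (tail x) (tail y)) ⟩
  ((c zero ∧ x zero) xor (c zero ∧ y zero)) xor (Σx xor Σy)
    ≡⟨ interchange (c zero ∧ x zero) (c zero ∧ y zero) Σx Σy ⟩
  xorSum c x xor xorSum c y ∎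
  where
  open ≡-Reasoning
  Σx = xorSum (tail c) (tail x)
  Σy = xorSum (tail c) (tail y)

xorSum-⊥ : ∀ {n} (c : Tuple n) → xorSum c (λ _ → false) ≡ false
xorSum-⊥ {zero}  c = refl
xorSum-⊥ {suc n} c with c zero
... | false = xorSum-⊥ (tail c)
... | true  = xorSum-⊥ (tail c)

L⊆Affine : L ⊆ Affine
L⊆Affine (_ , F) (c₀ , c , F≡) x y = begin
  F (x ⊕ y)                                     ≡⟨ F≡ (x ⊕ y) ⟩
  c₀ xor xorSum c (x ⊕ y)                       ≡⟨ cong (c₀ xor_) (xorSum-⊕ c x y) ⟩
  c₀ xor (xorSum c x xor xorSum c y)            ≡⟨ xor-affine c₀ _ _ ⟩
  ((c₀ xor xorSum c x) xor (c₀ xor xorSum c y)) xor (c₀ xor false)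
    ≡⟨ cong₂ _xor_ (cong₂ _xor_ (F≡ x) (F≡ y)) (cong (c₀ xor_) (xorSum-⊥ c)) ⟨
  (F x xor F y) xor (c₀ xor xorSum c (λ _ → false))
    ≡⟨ cong ((F x xor F y) xor_) (F≡ (λ _ → false)) ⟨
  (F x xor F y) xor F (λ _ → false)             ∎
  where open ≡-Reasoning

negate : BF → BF
negate (n , F) = n , not ∘ F

negate-selfDual : (f : BF) → S f → S (negate f)
negate-selfDual _ f-selfDual x = cong not (f-selfDual x)

negate-minor⁻¹ : (f g : BF) → IsMinorOf (negate f) (negate g) → IsMinorOf f g
negate-minor⁻¹ _ _ (σ , ¬f≡¬g∘σ) = σ , not-injective ∘ ¬f≡¬g∘σ

dualGlue : (P h : Tuple n → Bool) → Tuple n → Bool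
dualGlue P h x = if P x then h x else not (h (∁ x))

dualGlue-selfDual : (P h : Tuple (suc n) → Bool) →
                    (∀ x → P (∁ x) ≡ not (P x)) → (∀ x → h (∁ (∁ x)) ≡ h x) →
                    S (n , dualGlue P h)
dualGlue-selfDual P h P∁ h∁∁ x with P x in Px
... | true  rewrite P∁ x | Px = trans (sym (h∁∁ x)) (sym (not-involutive _))
... | false rewrite P∁ x | Px = refl

-- The antichain below SM

atLeastTwo : Tuple n → Bool
atLeastTwo x = does (2 ≤? weight x)

atLeastTwo-true⇒ : (x : Tuple n) → atLeastTwo x ≡ true → 2 ≤ weight x
atLeastTwo-true⇒ x = does≡true⇒ (2 ≤? weight x)

atLeastTwo-false⇒ : (x : Tuple n) → atLeastTwo x ≡ false → weight x ≤ 1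
atLeastTwo-false⇒ x ¬2≤x = ≤-pred (≰⇒> (does≡false⇒¬ (2 ≤? weight x) ¬2≤x))

atLeastTwo-mono : {x y : Tuple n} → (∀ i → x i ≤ᴮ y i) → atLeastTwo x ≤ᴮ atLeastTwo y
atLeastTwo-mono {x = x} {y} x≤y =
  does-mono (λ 2≤x → ≤-trans 2≤x (weight-mono x≤y)) (2 ≤? weight x) (2 ≤? weight y)

atLeastTwo-∁ : 3 ≤ n → (x : Tuple n) → not (atLeastTwo (∁ x)) ≤ᴮ atLeastTwo x
atLeastTwo-∁ 3≤n x = does-¬⇒ 2≤x (2 ≤? weight (∁ x)) (2 ≤? weight x)
  where
  2≤x : ¬ 2 ≤ weight (∁ x) → 2 ≤ weight x
  2≤x 2≰∁x = ≤-pred (≤-trans 3≤n (subst (_≤ suc (weight x))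
    (weight+weight∁≡n x) (subst (weight x + weight (∁ x) ≤_) (+-comm (weight x) 1)
      (+-monoʳ-≤ (weight x) (≤-pred (≰⇒> 2≰∁x))))))

switchThreshold : (k : ℕ) → Tuple (6 + k) → Bool
switchThreshold k = dualGlue (λ x → x zero) (atLeastTwo ∘ tail)

Ψ : ℕ → BF
Ψ k = 5 + k , switchThreshold k

Ψ-selfDual : (k : ℕ) → S (Ψ k)
Ψ-selfDual k = dualGlue-selfDual _ _ (λ _ → refl)
  (λ x → cong (does ∘ (2 ≤?_)) (weight-cong (not-involutive ∘ tail x)))

Ψ-monotone : (k : ℕ) → M (Ψ k)
Ψ-monotone k x y x≤y with x zero | y zero | x≤y zero
... | false | false | _ = not-antitone (atLeastTwo-mono (not-antitone ∘ x≤y ∘ suc))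
... | false | true  | _ =
  ≤ᴮ-trans (atLeastTwo-∁ (s≤s (s≤s (s≤s z≤n))) (tail x)) (atLeastTwo-mono (x≤y ∘ suc))
... | true  | true  | _ = atLeastTwo-mono (x≤y ∘ suc)

switchThreshold-⁅⁆ : ∀ {k} (i : Fin (6 + k)) → switchThreshold k ⁅ i ⁆ ≡ false
switchThreshold-⁅⁆ {k} zero    = cong (does ∘ (2 ≤?_)) (weight-⊥ (5 + k))
switchThreshold-⁅⁆     (suc r) =
  cong (not ∘ does ∘ (2 ≤?_)) (weight∁≡ 1 {⁅ r ⁆} (weight-⁅⁆ r))

Ψ∉Ic : (k : ℕ) → ¬ Ic (Ψ k)
Ψ∉Ic k (i , ψ≡xᵢ) =
  true≢false (trans (sym (⁅⁆-self i)) (trans (sym (ψ≡xᵢ ⁅ i ⁆)) (switchThreshold-⁅⁆ i)))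

forces-0-1 : ∀ {p a b} → p + a ≤ 1 → p + b ≤ 1 → 2 ≤ p + (a + b) → p ≡ 0 × a ≡ 1
forces-0-1 {0} {1}           _        _        _   = refl , refl
forces-0-1 {0} {0}           _        b≤1      2≤b = ⊥-elim (1+n≰n (≤-trans 2≤b b≤1))
forces-0-1 {0} {suc (suc _)} (s≤s ()) _        _
forces-0-1 {1} {0}   {0}     _        _        (s≤s ())
forces-0-1 {1} {0}   {suc _} _        (s≤s ()) _
forces-0-1 {1} {suc _}       (s≤s ()) _        _
forces-0-1 {suc (suc _)}     (s≤s ()) _        _

forces-1-1 : ∀ {p a b} → p + a ≤ 1 → a + b ≤ 1 → 2 ≤ p + (a + b) → p ≡ 1 × b ≡ 1
forces-1-1 {1} {0} {1}           _        _        _   = refl , refl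
forces-1-1 {0} {0}               _        b≤1      2≤b = ⊥-elim (1+n≰n (≤-trans 2≤b b≤1))
forces-1-1 {1} {0} {0}           _        _        (s≤s ())
forces-1-1 {1} {0} {suc (suc _)} _        (s≤s ()) _
forces-1-1 {0} {1} {0}           _        _        (s≤s ())
forces-1-1 {0} {1} {suc _}       _        (s≤s ()) _
forces-1-1 {0} {suc (suc _)}     (s≤s ()) _        _
forces-1-1 {1} {suc _}           (s≤s ()) _        _
forces-1-1 {suc (suc _)}         (s≤s ()) _        _

switchThreshold-on : ∀ {k} {z : Tuple (6 + k)} → z zero ≡ true →
                     switchThreshold k z ≡ atLeastTwo (tail z)
switchThreshold-on z₀ rewrite z₀ = refl

switchThreshold-off : ∀ {k} {z : Tuple (6 + k)} → z zero ≡ false →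
                      switchThreshold k z ≡ not (atLeastTwo (∁ (tail z)))
switchThreshold-off z₀ rewrite z₀ = refl

module _ {k : ℕ} where

  switchThreshold-⁅0,r⁆ : (r : Fin (5 + k)) →
                          switchThreshold k (⁅ zero ⁆ ∪ ⁅ suc r ⁆) ≡ false
  switchThreshold-⁅0,r⁆ r = cong (does ∘ (2 ≤?_)) (weight-⁅⁆ r)

  switchThreshold-⁅0,r,s⁆ : {r s : Fin (5 + k)} → r ≢ s →
                            switchThreshold k (⁅ zero ⁆ ∪ ⁅ suc r ⁆ ∪ ⁅ suc s ⁆) ≡ true
  switchThreshold-⁅0,r,s⁆ r≢s = cong (does ∘ (2 ≤?_)) (weight-pair r≢s)

  switchThreshold-⁅r,s⁆ : {r s : Fin (5 + k)} → r ≢ s →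
                          switchThreshold k (⁅ suc r ⁆ ∪ ⁅ suc s ⁆) ≡ false
  switchThreshold-⁅r,s⁆ {r} {s} r≢s =
    cong (not ∘ does ∘ (2 ≤?_)) (weight∁≡ 2 {⁅ r ⁆ ∪ ⁅ s ⁆} (weight-pair r≢s))

module SwitchThresholdMinor {j k : ℕ} (σ : Fin (6 + j) → Fin (6 + k))
  (ψₖ≡ψⱼ∘σ : ∀ y → switchThreshold k y ≡ switchThreshold j (y ∘ σ)) where

  c : Fin (6 + k) → ℕ
  c b = weight (⁅ b ⁆ ∘ tail σ)

  image : ∀ y {b} → switchThreshold k y ≡ b → switchThreshold j (y ∘ σ) ≡ b
  image y = trans (sym (ψₖ≡ψⱼ∘σ y))

  on-false : ∀ y → y (σ zero) ≡ true → switchThreshold k y ≡ false → weight (y ∘ tail σ) ≤ 1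
  on-false y y₀ ψy =
    atLeastTwo-false⇒ (y ∘ tail σ) (trans (sym (switchThreshold-on {z = y ∘ σ} y₀)) (image y ψy))

  on-true : ∀ y → y (σ zero) ≡ true → switchThreshold k y ≡ true → 2 ≤ weight (y ∘ tail σ)
  on-true y y₀ ψy =
    atLeastTwo-true⇒ (y ∘ tail σ) (trans (sym (switchThreshold-on {z = y ∘ σ} y₀)) (image y ψy))

  off-true : ∀ y → y (σ zero) ≡ false → switchThreshold k y ≡ true →
             5 + j ≤ weight (y ∘ tail σ) + 1
  off-true y y₀ ψy = subst (_≤ weight (y ∘ tail σ) + 1) (weight+weight∁≡n (y ∘ tail σ))
    (+-monoʳ-≤ (weight (y ∘ tail σ)) (atLeastTwo-false⇒ (∁ (y ∘ tail σ))
      (not-injective (trans (sym (switchThreshold-off {z = y ∘ σ} y₀)) (image y ψy)))))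

  switch-fixed : σ zero ≡ zero → j ≡ k
  switch-fixed σ₀ = +-cancelˡ-≡ 6 j k (singleton-fibres⇒≡ σ fibre≡1)
    where
    pair-bound : ∀ r → c zero + c (suc r) ≤ 1
    pair-bound r = subst (_≤ 1) (weight-pair∘ (tail σ) (λ ()))
      (on-false y (cong y σ₀) (switchThreshold-⁅0,r⁆ r))
      where y = ⁅ zero ⁆ ∪ ⁅ suc r ⁆

    triple-bound : ∀ {r s} → r ≢ s → 2 ≤ c zero + (c (suc r) + c (suc s))
    triple-bound {r} {s} r≢s =
      subst (2 ≤_) (weight-triple∘ (tail σ) ((λ ()) , (λ ()) , r≢s ∘ Fin.suc-injective))
        (on-true y (cong y σ₀) (switchThreshold-⁅0,r,s⁆ r≢s))
      where y = ⁅ zero ⁆ ∪ ⁅ suc r ⁆ ∪ ⁅ suc s ⁆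

    forced : ∀ r → c zero ≡ 0 × c (suc r) ≡ 1
    forced r with two-others r
    ... | s , _ , r≢s , _ = forces-0-1 (pair-bound r) (pair-bound s) (triple-bound r≢s)

    fibre≡1 : ∀ b → weight (⁅ b ⁆ ∘ σ) ≡ 1
    fibre≡1 zero    =
      trans (weight-head-true (⁅ zero ⁆ ∘ σ) (cong ⁅ zero ⁆ σ₀)) (cong suc (proj₁ (forced zero)))
    fibre≡1 (suc r) =
      trans (weight-head-false (⁅ suc r ⁆ ∘ σ) (cong ⁅ suc r ⁆ σ₀)) (proj₂ (forced r))

  -- If σ sends the switch to suc t, the bounds put exactly one further variable of ψⱼ over 0
  -- and over every suc u ≠ suc t; then ψₖ is true at {0, suc r, suc s} while ψⱼ, with its
  -- switch off, sees only three of its variables on.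
  switch-moved : ∀ t → σ zero ≡ suc t → ⊥
  switch-moved t σ₀ with two-others t
  ... | r , s , t≢r , t≢s , r≢s = 5+j≰4 (subst (λ w → 5 + j ≤ w + 1) weight≡3
          (off-true (⁅ zero ⁆ ∪ ⁅ suc r ⁆ ∪ ⁅ suc s ⁆) r,s∌t (switchThreshold-⁅0,r,s⁆ r≢s)))
    where
    at-t : ∀ (y : Tuple (6 + k)) {b} → y (suc t) ≡ b → y (σ zero) ≡ b
    at-t y = trans (cong y σ₀)

    t-bound : c zero + c (suc t) ≤ 1
    t-bound = subst (_≤ 1) (weight-pair∘ (tail σ) (λ ()))
      (on-false y (at-t y (⁅⁆-self t)) (switchThreshold-⁅0,r⁆ t))
      where y = ⁅ zero ⁆ ∪ ⁅ suc t ⁆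

    pair-bound : ∀ {u} → t ≢ u → c (suc t) + c (suc u) ≤ 1
    pair-bound {u} t≢u = subst (_≤ 1) (weight-pair∘ (tail σ) (t≢u ∘ Fin.suc-injective))
      (on-false y (at-t y (cong (_∨ ⁅ u ⁆ t) (⁅⁆-self t))) (switchThreshold-⁅r,s⁆ t≢u))
      where y = ⁅ suc t ⁆ ∪ ⁅ suc u ⁆

    triple-bound : ∀ {u} → t ≢ u → 2 ≤ c zero + (c (suc t) + c (suc u))
    triple-bound {u} t≢u =
      subst (2 ≤_) (weight-triple∘ (tail σ) ((λ ()) , (λ ()) , t≢u ∘ Fin.suc-injective))
        (on-true y (at-t y (cong (_∨ ⁅ u ⁆ t) (⁅⁆-self t))) (switchThreshold-⁅0,r,s⁆ t≢u))
      where y = ⁅ zero ⁆ ∪ ⁅ suc t ⁆ ∪ ⁅ suc u ⁆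

    forced : ∀ {u} → t ≢ u → c zero ≡ 1 × c (suc u) ≡ 1
    forced t≢u = forces-1-1 t-bound (pair-bound t≢u) (triple-bound t≢u)

    r,s∌t : (⁅ zero ⁆ ∪ ⁅ suc r ⁆ ∪ ⁅ suc s ⁆) (σ zero) ≡ false
    r,s∌t = at-t (⁅ zero ⁆ ∪ ⁅ suc r ⁆ ∪ ⁅ suc s ⁆)
      (cong₂ _∨_ (dec-false (t ≟ r) t≢r) (dec-false (t ≟ s) t≢s))

    weight≡3 : weight ((⁅ zero ⁆ ∪ ⁅ suc r ⁆ ∪ ⁅ suc s ⁆) ∘ tail σ) ≡ 3
    weight≡3 = trans (weight-triple∘ (tail σ) ((λ ()) , (λ ()) , r≢s ∘ Fin.suc-injective))
      (cong₂ _+_ (proj₁ (forced t≢r)) (cong₂ _+_ (proj₂ (forced t≢r)) (proj₂ (forced t≢s))))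

    5+j≰4 : ¬ 5 + j ≤ 4
    5+j≰4 (s≤s (s≤s (s≤s (s≤s ()))))

Ψ-antichain : ∀ j k → IsMinorOf (Ψ k) (Ψ j) → j ≡ k
Ψ-antichain j k (σ , ψₖ≡ψⱼ∘σ) = by-switch (σ zero) refl
  where
  open SwitchThresholdMinor σ ψₖ≡ψⱼ∘σ
  by-switch : ∀ b → σ zero ≡ b → j ≡ k
  by-switch zero    σ₀ = switch-fixed σ₀
  by-switch (suc t) σ₀ = ⊥-elim (switch-moved t σ₀)

-- The antichain below S

lower-half-∁ : ∀ h (x : Tuple (suc (h + h))) →
               does (weight (∁ x) ≤? h) ≡ not (does (weight x ≤? h))
lower-half-∁ h x = by-cases (weight x ≤? h) (weight (∁ x) ≤? h)
  where
  total = weight+weight∁≡n x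
  by-cases : (a? : Dec (weight x ≤ h)) (b? : Dec (weight (∁ x) ≤ h)) → does b? ≡ not (does a?)
  by-cases (yes x≤h) (yes ∁x≤h) =
    ⊥-elim (1+n≰n (subst (_≤ h + h) total (+-mono-≤ x≤h ∁x≤h)))
  by-cases (yes _)   (no _)     = refl
  by-cases (no _)    (yes _)    = refl
  by-cases (no x≰h)  (no ∁x≰h)  =
    ⊥-elim (1+n≰n (subst₂ _≤_ (cong suc (+-suc h h)) total (+-mono-≤ (≰⇒> x≰h) (≰⇒> ∁x≰h))))

selfDualWeightOne : (k : ℕ) → Tuple (suc ((3 + k) + (3 + k))) → Bool
selfDualWeightOne k = dualGlue (λ x → does (weight x ≤? 3 + k)) (λ x → does (weight x ℕ.≟ 1))

Φ : ℕ → BF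
Φ k = (3 + k) + (3 + k) , selfDualWeightOne k

module _ (k : ℕ) where

  Φ-low : (x : Tuple (suc ((3 + k) + (3 + k)))) → weight x ≤ 3 + k →
          selfDualWeightOne k x ≡ does (weight x ℕ.≟ 1)
  Φ-low x low rewrite dec-true (weight x ≤? 3 + k) low = refl

  Φ-high : (x : Tuple (suc ((3 + k) + (3 + k)))) → ¬ weight x ≤ 3 + k →
           selfDualWeightOne k x ≡ not (does (weight (∁ x) ℕ.≟ 1))
  Φ-high x high rewrite dec-false (weight x ≤? 3 + k) high = refl

  Φ-by-weight : ∀ {w} (x : Tuple (suc ((3 + k) + (3 + k)))) → weight x ≡ w → w ≤ 3 + k →
                selfDualWeightOne k x ≡ does (w ℕ.≟ 1)
  Φ-by-weight x refl = Φ-low x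

  Φ-true-low⇒1 : (x : Tuple (suc ((3 + k) + (3 + k)))) → selfDualWeightOne k x ≡ true →
                 weight x ≤ 3 + k → weight x ≡ 1
  Φ-true-low⇒1 x Φx low = does≡true⇒ (weight x ℕ.≟ 1) (trans (sym (Φ-low x low)) Φx)

  Φ-false-high⇒ : (x : Tuple (suc ((3 + k) + (3 + k)))) → selfDualWeightOne k x ≡ false →
                  ¬ weight x ≤ 3 + k → weight x ≡ (3 + k) + (3 + k)
  Φ-false-high⇒ x Φx high = suc-injective (begin
    suc (weight x)           ≡⟨ +-comm 1 (weight x) ⟩
    weight x + 1             ≡⟨ cong (weight x +_) ∁x≡1 ⟨
    weight x + weight (∁ x)  ≡⟨ weight+weight∁≡n x ⟩
    suc ((3 + k) + (3 + k))  ∎)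
    where
    open ≡-Reasoning
    ∁x≡1 : weight (∁ x) ≡ 1
    ∁x≡1 = does≡true⇒ (weight (∁ x) ℕ.≟ 1) (not-injective (trans (sym (Φ-high x high)) Φx))

  Φ-⁅r⁆ : (r : Fin (suc ((3 + k) + (3 + k)))) → selfDualWeightOne k ⁅ r ⁆ ≡ true
  Φ-⁅r⁆ r = Φ-by-weight ⁅ r ⁆ (weight-⁅⁆ r) (s≤s z≤n)

  Φ-⁅r,s⁆ : {r s : Fin (suc ((3 + k) + (3 + k)))} → r ≢ s →
            selfDualWeightOne k (⁅ r ⁆ ∪ ⁅ s ⁆) ≡ false
  Φ-⁅r,s⁆ {r} {s} r≢s = Φ-by-weight (⁅ r ⁆ ∪ ⁅ s ⁆) (weight-pair r≢s) (s≤s (s≤s z≤n))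

  Φ-⁅r,s,u⁆ : {r s u : Fin (suc ((3 + k) + (3 + k)))} → Distinct r s u →
              selfDualWeightOne k (⁅ r ⁆ ∪ ⁅ s ⁆ ∪ ⁅ u ⁆) ≡ false
  Φ-⁅r,s,u⁆ {r} {s} {u} d =
    Φ-by-weight (⁅ r ⁆ ∪ ⁅ s ⁆ ∪ ⁅ u ⁆) (weight-triple d) (s≤s (s≤s (s≤s z≤n)))

  Φ-⊥ : selfDualWeightOne k (λ _ → false) ≡ false
  Φ-⊥ = Φ-by-weight (λ _ → false) (weight-⊥ (suc ((3 + k) + (3 + k)))) z≤n

Φ-selfDual : (k : ℕ) → S (Φ k)
Φ-selfDual k = dualGlue-selfDual _ _ (lower-half-∁ (3 + k))
  (λ x → cong (λ w → does (w ℕ.≟ 1)) (weight-cong (not-involutive ∘ x)))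

Φ∈Sc : (k : ℕ) → Sc (Φ k)
Φ∈Sc k = Φ-selfDual k , selfDual⇒Tc (Φ k) (Φ-selfDual k) (Φ-⊥ k)

Φ∉M : (k : ℕ) → ¬ M (Φ k)
Φ∉M k mono with subst₂ _≤ᴮ_ (Φ-⁅r⁆ k zero) (Φ-⁅r,s⁆ k {zero} {suc zero} (λ ()))
                  (mono ⁅ zero ⁆ (⁅ zero ⁆ ∪ ⁅ suc zero ⁆) (λ i → ≤∨ _ _))
... | ()

Φ∉Affine : (k : ℕ) → ¬ Affine (Φ k)
Φ∉Affine k affine = true≢false (sym (begin
  false                        ≡⟨ Φ-by-weight k (x ⊕ y) weight-x⊕y (s≤s (s≤s (s≤s z≤n))) ⟨
  selfDualWeightOne k (x ⊕ y)  ≡⟨ affine x y ⟩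
  (selfDualWeightOne k x xor selfDualWeightOne k y) xor selfDualWeightOne k (λ _ → false)
    ≡⟨ cong₂ _xor_ (cong₂ _xor_ (Φ-⁅r⁆ k zero) (Φ-⁅r,s⁆ k {suc zero} {suc (suc zero)} (λ ())))
                   (Φ-⊥ k) ⟩
  true                         ∎))
  where
  open ≡-Reasoning

  x y : Tuple (suc ((3 + k) + (3 + k)))
  x = ⁅ zero ⁆
  y = ⁅ suc zero ⁆ ∪ ⁅ suc (suc zero) ⁆

  x#y : Disjoint x y
  x#y = disjoint-∪ {x = x} (⁅⁆-disjoint (λ ())) (⁅⁆-disjoint (λ ()))

  weight-x⊕y : weight (x ⊕ y) ≡ 3
  weight-x⊕y = trans (weight-cong {x = x ⊕ y} (⊕≗∪ {x = x} {y} x#y))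
    (weight-triple {n = suc ((3 + k) + (3 + k))} {zero} {suc zero} {suc (suc zero)}
                   ((λ ()) , (λ ()) , (λ ())))

double-injective : ∀ {a b} → a + a ≡ b + b → a ≡ b
double-injective {zero}  {zero}  _  = refl
double-injective {suc a} {suc b} eq =
  cong suc (double-injective (suc-injective
    (trans (sym (+-suc a a)) (trans (suc-injective eq) (+-suc b b)))))

Φ-antichain : ∀ j k → IsMinorOf (Φ k) (Φ j) → j ≡ k
Φ-antichain j k (σ , φₖ≡φⱼ∘σ) =
  +-cancelˡ-≡ 3 j k (double-injective (suc-injective (singleton-fibres⇒≡ σ fibre≡1)))
  where
  c : Fin (suc ((3 + k) + (3 + k))) → ℕ
  c r = weight (⁅ r ⁆ ∘ σ)

  image : ∀ y {b} → selfDualWeightOne k y ≡ b → selfDualWeightOne j (y ∘ σ) ≡ b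
  image y = trans (sym (φₖ≡φⱼ∘σ y))

  fibre≡1 : ∀ r → c r ≡ 1
  fibre≡1 r with c r ≤? 3 + j
  ... | yes low  = Φ-true-low⇒1 j (⁅ r ⁆ ∘ σ) (image ⁅ r ⁆ (Φ-⁅r⁆ k r)) low
  ... | no  high with two-others r
  ...   | s , u , r≢s , r≢u , s≢u = ⊥-elim (0≢1+n (trans (sym cu≡0) cu≡1))
    where
    -- A fibre outside the lower half makes both the pair {r, s} and the triple {u, r, s}
    -- land on the unique false weight 2m of the upper half, so the fibre of u is empty.
    pair-full : c r + c s ≡ (3 + j) + (3 + j)
    pair-full = trans (sym (weight-pair∘ σ r≢s))
      (Φ-false-high⇒ j ((⁅ r ⁆ ∪ ⁅ s ⁆) ∘ σ) (image (⁅ r ⁆ ∪ ⁅ s ⁆) (Φ-⁅r,s⁆ k r≢s))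
        (λ low → high (≤-trans (m≤m+n (c r) (c s)) (subst (_≤ 3 + j) (weight-pair∘ σ r≢s) low))))

    u∪pair : Distinct u r s
    u∪pair = r≢u ∘ sym , s≢u ∘ sym , r≢s

    triple-full : c u + (c r + c s) ≡ (3 + j) + (3 + j)
    triple-full = trans (sym (weight-triple∘ σ u∪pair))
      (Φ-false-high⇒ j ((⁅ u ⁆ ∪ ⁅ r ⁆ ∪ ⁅ s ⁆) ∘ σ)
        (image (⁅ u ⁆ ∪ ⁅ r ⁆ ∪ ⁅ s ⁆) (Φ-⁅r,s,u⁆ k u∪pair))
        (λ low → high (≤-trans (≤-trans (m≤m+n (c r) (c s)) (m≤n+m _ (c u)))
          (subst (_≤ 3 + j) (weight-triple∘ σ u∪pair) low))))

    cu≡0 : c u ≡ 0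
    cu≡0 = +-cancelʳ-≡ (c r + c s) (c u) 0 (trans triple-full (sym pair-full))

    cu≡1 : c u ≡ 1
    cu≡1 = Φ-true-low⇒1 j (⁅ u ⁆ ∘ σ) (image ⁅ u ⁆ (Φ-⁅r⁆ k u))
      (subst (_≤ 3 + j) (sym cu≡0) z≤n)

negatedΦ∉Tc : (k : ℕ) → ¬ Tc (negate (Φ k))
negatedΦ∉Tc k (¬Φ₀≡false , _) = true≢false (trans (sym (not-injective ¬Φ₀≡false)) (Φ-⊥ k))

interval-Ic-SM : SeparatingAntichain Ic SM
interval-Ic-SM = record
  { D₂-equational = ∩-equational S-equational M-equational
  ; D₁⊆D₂         = Ic⊆SM
  ; C             = Ic
  ; C-equational  = Ic-equational
  ; D₁⊆C          = λ _ → id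
  ; φ             = Ψ
  ; φ∈D₂          = λ k → Ψ-selfDual k , Ψ-monotone k
  ; φ∉C           = Ψ∉Ic
  ; antichain     = Ψ-antichain
  }

interval-MSc-Sc : SeparatingAntichain (M ∩ Sc) Sc
interval-MSc-Sc = record
  { D₂-equational = ∩-equational S-equational Tc-equational
  ; D₁⊆D₂         = λ _ → proj₂
  ; C             = M
  ; C-equational  = M-equational
  ; D₁⊆C          = λ _ → proj₁
  ; φ             = Φ
  ; φ∈D₂          = Φ∈Sc
  ; φ∉C           = Φ∉M
  ; antichain     = Φ-antichain
  }

interval-LSc-Sc : SeparatingAntichain (L ∩ Sc) Sc
interval-LSc-Sc = record
  { D₂-equational = ∩-equational S-equational Tc-equational
  ; D₁⊆D₂         = λ _ → proj₂
  ; C             = Affine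
  ; C-equational  = Affine-equational
  ; D₁⊆C          = λ f → L⊆Affine f ∘ proj₁
  ; φ             = Φ
  ; φ∈D₂          = Φ∈Sc
  ; φ∉C           = Φ∉Affine
  ; antichain     = Φ-antichain
  }

interval-TcS-S : SeparatingAntichain (Tc ∩ S) S
interval-TcS-S = record
  { D₂-equational = S-equational
  ; D₁⊆D₂         = λ _ → proj₂
  ; C             = Tc
  ; C-equational  = Tc-equational
  ; D₁⊆C          = λ _ → proj₁
  ; φ             = negate ∘ Φ
  ; φ∈D₂          = λ k → negate-selfDual (Φ k) (Φ-selfDual k)
  ; φ∉C           = negatedΦ∉Tc
  ; antichain     = λ j k → Φ-antichain j k ∘ negate-minor⁻¹ (Φ k) (Φ j)
  }

interval-LS-S : SeparatingAntichain (L ∩ S) S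
interval-LS-S = record
  { D₂-equational = S-equational
  ; D₁⊆D₂         = λ _ → proj₂
  ; C             = Affine
  ; C-equational  = Affine-equational
  ; D₁⊆C          = λ f → L⊆Affine f ∘ proj₁
  ; φ             = Φ
  ; φ∈D₂          = Φ-selfDual
  ; φ∉C           = Φ∉Affine
  ; antichain     = Φ-antichain
  }

proposition10 : UncountableInterval Ic SM
    × (UncountableInterval (M ∩ Sc) Sc × UncountableInterval (L ∩ Sc) Sc)
    × (UncountableInterval (Tc ∩ S) S × UncountableInterval (L ∩ S) S)
proposition10 =
  uncountable interval-Ic-SM ,
  (uncountable interval-MSc-Sc , uncountable interval-LSc-Sc) ,
  (uncountable interval-TcS-S , uncountable interval-LS-S)
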